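{- Let $a,b$ be integers with $a-1>b\ge 1$, let $\varphi$ be the morphism of $\{0,1\}^*$ given by $\varphi(0)=0^a1$, $\varphi(1)=0^b1$, and let $u_\beta=\lim_{n\to\infty}\varphi^n(0)$ be its fixed point. If $10^r1$ is a factor of $u_\beta$, then $r=a$ or $r=b$. Moreover, if $v$ is a left special factor of $u_\beta$ containing the letter $1$, then $v$ has the prefix $0^b1$; and if $v$ is a right special factor of $u_\beta$ containing the letter $1$, then $v$ has the suffix $10^b$.
   Context: A finite word $w$ is a factor of an infinite word $u$ if $u=w^{(1)}ww^{(2)}$ for some finite $w^{(1)}$ and infinite $w^{(2)}$. A factor $w$ of $u$ is left special if there are two distinct letters $x,y$ with $xw$ and $yw$ both factors of $u$; it is right special if there are two distinct letters $x,y$ with $wx$ and $wy$ both factors of $u$. -}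

module Defs where

open import Data.Nat using (ℕ; zero; suc; _+_)
open import Data.List using (List; []; _∷_; _++_; replicate; concatMap; tabulate)
open import Data.Maybe using (Maybe; just; nothing)
open import Data.Product using (∃; ∃-syntax; _×_)
open import Relation.Binary.PropositionalEquality using (_≡_; _≢_)

data Letter : Set where
  𝟘 𝟙 : Letter

φ : ℕ → ℕ → Letter → List Letter
φ a b 𝟘 = replicate a 𝟘 ++ (𝟙 ∷ [])
φ a b 𝟙 = replicate b 𝟘 ++ (𝟙 ∷ [])

φ* : ℕ → ℕ → List Letter → List Letter
φ* a b = concatMap (φ a b)

φⁿ0 : ℕ → ℕ → ℕ → List Letter
φⁿ0 a b zero    = 𝟘 ∷ []
φⁿ0 a b (suc n) = φ* a b (φⁿ0 a b n)

nth : List Letter → ℕ → Letter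
nth []       _       = 𝟘
nth (x ∷ xs) zero    = x
nth (x ∷ xs) (suc i) = nth xs i

-- the fixed point u_β = lim φ^n(0), as an infinite word ℕ → Letter:
-- its i-th letter is the i-th letter of φ^(i+1)(0) (which has length > i
-- when a ≥ 1, and φ^n(0) is a prefix of φ^(n+1)(0) since φ(0) begins with 0).
u : ℕ → ℕ → ℕ → Letter
u a b i = nth (φⁿ0 a b (suc i)) i

Factor : (ℕ → Letter) → List Letter → Set
Factor x w = ∃[ i ] (tabulate {n = Data.List.length w} (λ j → x (i + Data.Fin.toℕ j)) ≡ w)
  where import Data.Fin

LeftSpecial : (ℕ → Letter) → List Letter → Set
LeftSpecial x w = ∃[ c ] ∃[ d ] (c ≢ d × Factor x (c ∷ w) × Factor x (d ∷ w))

RightSpecial : (ℕ → Letter) → List Letter → Set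
RightSpecial x w = ∃[ c ] ∃[ d ] (c ≢ d × Factor x (w ++ c ∷ []) × Factor x (w ++ d ∷ []))

HasPrefix : List Letter → List Letter → Set
HasPrefix v p = ∃[ s ] (v ≡ p ++ s)

HasSuffix : List Letter → List Letter → Set
HasSuffix v s = ∃[ p ] (v ≡ p ++ s)

-- Since u is the fixed point of φ, every factor of u is a factor of a finite block word φ(y),
-- a concatenation of the blocks 0^a 1 and 0^b 1. In a block word the letters after a 1 begin
-- a new block, so a factor 1 0^r 1 has r ∈ {a, b}, and since b ≤ a there is no factor 0^(a+1).
-- A left (right) special factor containing 1 is 0^k 1 w (resp. w 1 0^k); one of its two
-- extensions contains 1 0^k 1, forcing k ∈ {a, b}, the other contains 0^(k+1), forcing k < a.

module Submission where

open import Defs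
open import Data.Nat using (ℕ; zero; suc; _+_; _≤_; _<_; z≤n; s≤s; _≤′_; ≤′-refl; ≤′-step)
open import Data.Nat.Properties
  using (≤-trans; ≤-antisym; ≤-total; <-≤-trans; <-irrefl; <⇒≤; n≤1+n; m≤n+m; m<m+n; m+n≤o⇒m≤o; +-comm; +-monoʳ-<; ≤⇒≤′)
open import Data.List using (List; []; _∷_; _++_; replicate; length; tabulate; take; drop)
open import Data.List.Properties
  using (++-assoc; ++-identityʳ; ∷-injectiveʳ; length-++; length-++-≤ʳ; concatMap-++; tabulate-cong; take++drop≡id)
open import Data.List.Membership.Propositional using (_∈_)
open import Data.List.Relation.Unary.Any using (here; there)
open import Data.Fin using (toℕ)
open import Data.Fin.Properties using (toℕ<n)
open import Data.Product using (_×_; _,_; ∃-syntax)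
open import Data.Sum using (_⊎_; inj₁; inj₂)
open import Data.Empty using (⊥-elim)
open import Relation.Nullary using (¬_)
open import Relation.Binary.PropositionalEquality using (_≡_; _≢_; refl; sym; trans; cong; subst; module ≡-Reasoning)

replicate-+-++ : ∀ {A : Set} m n (x : A) {s} → replicate m x ++ replicate n x ++ s ≡ replicate (m + n) x ++ s
replicate-+-++ zero    n x = refl
replicate-+-++ (suc m) n x = cong (x ∷_) (replicate-+-++ m n x)

nth-++ˡ : ∀ xs ys {i} → i < length xs → nth (xs ++ ys) i ≡ nth xs i
nth-++ˡ (x ∷ xs) ys {zero}  _         = refl
nth-++ˡ (x ∷ xs) ys {suc i} (s≤s i<n) = nth-++ˡ xs ys i<n

tabulate-nth : ∀ w i n → i + n ≤ length w → tabulate {n = n} (λ j → nth w (i + toℕ j)) ≡ take n (drop i w)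
tabulate-nth w       zero    zero    _        = refl
tabulate-nth (c ∷ w) zero    (suc n) (s≤s le) = cong (c ∷_) (tabulate-nth w zero n le)
tabulate-nth (c ∷ w) (suc i) n       (s≤s le) = tabulate-nth w i n le

both-letters : (P : Letter → Set) {c d : Letter} → c ≢ d → P c → P d → P 𝟘 × P 𝟙
both-letters P {𝟘} {𝟘} c≢d _  _  = ⊥-elim (c≢d refl)
both-letters P {𝟘} {𝟙} _   pc pd = pc , pd
both-letters P {𝟙} {𝟘} _   pc pd = pd , pc
both-letters P {𝟙} {𝟙} c≢d _  _  = ⊥-elim (c≢d refl)

𝟙∉𝟘ᵏ : ∀ k → ¬ 𝟙 ∈ replicate k 𝟘
𝟙∉𝟘ᵏ (suc k) (here ())
𝟙∉𝟘ᵏ (suc k) (there 𝟙∈) = 𝟙∉𝟘ᵏ k 𝟙∈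

first-𝟙 : ∀ {v} → 𝟙 ∈ v → ∃[ k ] ∃[ w ] v ≡ replicate k 𝟘 ++ 𝟙 ∷ w
first-𝟙 {𝟙 ∷ v} _ = 0 , v , refl
first-𝟙 {𝟘 ∷ v} (there 𝟙∈v) with k , w , refl ← first-𝟙 𝟙∈v = suc k , w , refl

zeros-or-last-𝟙 : ∀ v → (∃[ k ] v ≡ replicate k 𝟘) ⊎ (∃[ w ] ∃[ k ] v ≡ w ++ 𝟙 ∷ replicate k 𝟘)
zeros-or-last-𝟙 [] = inj₁ (0 , refl)
zeros-or-last-𝟙 (c ∷ v) with zeros-or-last-𝟙 v
... | inj₂ (w , k , refl) = inj₂ (c ∷ w , k , refl)
zeros-or-last-𝟙 (𝟘 ∷ v) | inj₁ (k , refl) = inj₁ (suc k , refl)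
zeros-or-last-𝟙 (𝟙 ∷ v) | inj₁ (k , refl) = inj₂ ([] , k , refl)

last-𝟙 : ∀ {v} → 𝟙 ∈ v → ∃[ w ] ∃[ k ] v ≡ w ++ 𝟙 ∷ replicate k 𝟘
last-𝟙 {v} 𝟙∈v with zeros-or-last-𝟙 v
... | inj₁ (k , refl) = ⊥-elim (𝟙∉𝟘ᵏ k 𝟙∈v)
... | inj₂ last = last

leading-𝟘s-≤ : ∀ k n {t s} → replicate k 𝟘 ++ 𝟙 ∷ t ≡ replicate n 𝟘 ++ s → n ≤ k
leading-𝟘s-≤ k       zero    _  = z≤n
leading-𝟘s-≤ zero    (suc n) ()
leading-𝟘s-≤ (suc k) (suc n) eq = s≤s (leading-𝟘s-≤ k n (∷-injectiveʳ eq))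

leading-𝟘s-unique : ∀ k n {t s} → replicate k 𝟘 ++ 𝟙 ∷ t ≡ replicate n 𝟘 ++ 𝟙 ∷ s → k ≡ n
leading-𝟘s-unique k n eq = ≤-antisym (leading-𝟘s-≤ n k (sym eq)) (leading-𝟘s-≤ k n eq)

𝟘ᵏ𝟙-split-at-𝟙 : ∀ k p {y t} → replicate k 𝟘 ++ 𝟙 ∷ y ≡ p ++ 𝟙 ∷ t → t ≡ y ⊎ ∃[ p′ ] y ≡ p′ ++ 𝟙 ∷ t
𝟘ᵏ𝟙-split-at-𝟙 zero    []      eq = inj₁ (sym (∷-injectiveʳ eq))
𝟘ᵏ𝟙-split-at-𝟙 zero    (_ ∷ p) eq = inj₂ (p , ∷-injectiveʳ eq)
𝟘ᵏ𝟙-split-at-𝟙 (suc k) []      ()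
𝟘ᵏ𝟙-split-at-𝟙 (suc k) (_ ∷ p) eq = 𝟘ᵏ𝟙-split-at-𝟙 k p (∷-injectiveʳ eq)

φ𝟘-proper-extension : ∀ {a} b → 1 ≤ a → ∃[ t ] φ a b 𝟘 ≡ 𝟘 ∷ t × 1 ≤ length t
φ𝟘-proper-extension {suc a} b _ = replicate a 𝟘 ++ 𝟙 ∷ [] , refl , length-++-≤ʳ (𝟙 ∷ []) {replicate a 𝟘}

module _ (a b : ℕ) where

  blockLength : Letter → ℕ
  blockLength 𝟘 = a
  blockLength 𝟙 = b

  φ*-∷ : ∀ c y → φ* a b (c ∷ y) ≡ replicate (blockLength c) 𝟘 ++ 𝟙 ∷ φ* a b y
  φ*-∷ 𝟘 y = ++-assoc (replicate a 𝟘) (𝟙 ∷ []) (φ* a b y)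
  φ*-∷ 𝟙 y = ++-assoc (replicate b 𝟘) (𝟙 ∷ []) (φ* a b y)

  φ*-after-𝟙 : ∀ y p {t} → φ* a b y ≡ p ++ 𝟙 ∷ t → ∃[ y′ ] t ≡ φ* a b y′
  φ*-after-𝟙 []      []      ()
  φ*-after-𝟙 []      (_ ∷ _) ()
  φ*-after-𝟙 (c ∷ y) p       eq with 𝟘ᵏ𝟙-split-at-𝟙 (blockLength c) p (trans (sym (φ*-∷ c y)) eq)
  ... | inj₁ t≡φ*y       = y , t≡φ*y
  ... | inj₂ (p′ , eq′) = φ*-after-𝟙 y p′ eq′

  φ*-first-gap : ∀ y {r s} → φ* a b y ≡ replicate r 𝟘 ++ 𝟙 ∷ s → r ≡ a ⊎ r ≡ b
  φ*-first-gap []      {zero}  ()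
  φ*-first-gap []      {suc r} ()
  φ*-first-gap (𝟘 ∷ y) {r}     eq = inj₁ (sym (leading-𝟘s-unique a r (trans (sym (φ*-∷ 𝟘 y)) eq)))
  φ*-first-gap (𝟙 ∷ y) {r}     eq = inj₂ (sym (leading-𝟘s-unique b r (trans (sym (φ*-∷ 𝟙 y)) eq)))

  φ*-leading-𝟘s-≤ : b ≤ a → ∀ y {n s} → φ* a b y ≡ replicate n 𝟘 ++ s → n ≤ a
  φ*-leading-𝟘s-≤ _   []      {zero}  _  = z≤n
  φ*-leading-𝟘s-≤ _   []      {suc n} ()
  φ*-leading-𝟘s-≤ _   (𝟘 ∷ y) {n}     eq = leading-𝟘s-≤ a n (trans (sym (φ*-∷ 𝟘 y)) eq)
  φ*-leading-𝟘s-≤ b≤a (𝟙 ∷ y) {n}     eq = ≤-trans (leading-𝟘s-≤ b n (trans (sym (φ*-∷ 𝟙 y)) eq)) b≤a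

  φ*-suffix : ∀ y p {t} → φ* a b y ≡ p ++ t → ∃[ j ] ∃[ y′ ] φ* a b y′ ≡ replicate j 𝟘 ++ t
  φ*-suffix y p {t} eq with zeros-or-last-𝟙 p
  ... | inj₁ (j , refl) = j , y , eq
  ... | inj₂ (p′ , j , refl)
    with y′ , t≡φ*y′ ← φ*-after-𝟙 y p′ (trans eq (++-assoc p′ (𝟙 ∷ replicate j 𝟘) t)) =
    j , y′ , sym t≡φ*y′

  BlockFactor : List Letter → Set
  BlockFactor w = ∃[ y ] ∃[ p ] ∃[ s ] φ* a b y ≡ p ++ w ++ s

  BlockFactor-suffix : ∀ p {w} → BlockFactor (p ++ w) → BlockFactor w
  BlockFactor-suffix p {w} (y , p′ , s , eq) = y , p′ ++ p , s , (begin
    φ* a b y                ≡⟨ eq ⟩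
    p′ ++ (p ++ w) ++ s     ≡⟨ cong (p′ ++_) (++-assoc p w s) ⟩
    p′ ++ p ++ w ++ s       ≡⟨ ++-assoc p′ p (w ++ s) ⟨
    (p′ ++ p) ++ w ++ s     ∎)
    where open ≡-Reasoning

  BlockFactor-gap : ∀ {r s} → BlockFactor (𝟙 ∷ replicate r 𝟘 ++ 𝟙 ∷ s) → r ≡ a ⊎ r ≡ b
  BlockFactor-gap {r} {s} (y , p , s′ , eq) with y′ , t≡φ*y′ ← φ*-after-𝟙 y p eq =
    φ*-first-gap y′ (trans (sym t≡φ*y′) (++-assoc (replicate r 𝟘) (𝟙 ∷ s) s′))

  BlockFactor-zero-run : b ≤ a → ∀ {m s} → BlockFactor (replicate m 𝟘 ++ s) → m ≤ a
  BlockFactor-zero-run b≤a {m} {s} (y , p , s′ , eq) with j , y′ , eq′ ← φ*-suffix y p eq =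
    ≤-trans (m≤n+m m j) (φ*-leading-𝟘s-≤ b≤a y′ (begin
      φ* a b y′                                   ≡⟨ eq′ ⟩
      replicate j 𝟘 ++ (replicate m 𝟘 ++ s) ++ s′ ≡⟨ cong (replicate j 𝟘 ++_) (++-assoc (replicate m 𝟘) s s′) ⟩
      replicate j 𝟘 ++ replicate m 𝟘 ++ s ++ s′   ≡⟨ replicate-+-++ j m 𝟘 ⟩
      replicate (j + m) 𝟘 ++ s ++ s′              ∎))
    where open ≡-Reasoning

  length-φ* : ∀ w → length w ≤ length (φ* a b w)
  length-φ* []      = z≤n
  length-φ* (c ∷ w) rewrite φ*-∷ c w = ≤-trans (s≤s (length-φ* w)) (length-++-≤ʳ (𝟙 ∷ φ* a b w) {replicate (blockLength c) 𝟘})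

  module _ (1≤a : 1 ≤ a) where

    φⁿ0-extends : ∀ n → ∃[ t ] φⁿ0 a b (suc n) ≡ φⁿ0 a b n ++ t × 1 ≤ length t
    φⁿ0-extends zero with t , eq , 1≤t ← φ𝟘-proper-extension b 1≤a =
      t , trans (++-identityʳ (φ a b 𝟘)) eq , 1≤t
    φⁿ0-extends (suc n) with t , eq , 1≤t ← φⁿ0-extends n =
      φ* a b t , trans (cong (φ* a b) eq) (concatMap-++ (φ a b) (φⁿ0 a b n) t) , ≤-trans 1≤t (length-φ* t)

    n<length-φⁿ0 : ∀ n → n < length (φⁿ0 a b n)
    n<length-φⁿ0 zero = s≤s z≤n
    n<length-φⁿ0 (suc n) with t , eq , 1≤t ← φⁿ0-extends n rewrite eq | length-++ (φⁿ0 a b n) {t} =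
      ≤-trans (s≤s (n<length-φⁿ0 n)) (m<m+n _ 1≤t)

    φⁿ0-prefix : ∀ {m n} → m ≤′ n → ∃[ t ] φⁿ0 a b n ≡ φⁿ0 a b m ++ t
    φⁿ0-prefix ≤′-refl = [] , sym (++-identityʳ _)
    φⁿ0-prefix {m} (≤′-step {n} m≤′n) with t , eq ← φⁿ0-prefix m≤′n | t′ , eq′ , _ ← φⁿ0-extends n =
      t ++ t′ , (begin
        φⁿ0 a b (suc n)          ≡⟨ eq′ ⟩
        φⁿ0 a b n ++ t′          ≡⟨ cong (_++ t′) eq ⟩
        (φⁿ0 a b m ++ t) ++ t′   ≡⟨ ++-assoc (φⁿ0 a b m) t t′ ⟩
        φⁿ0 a b m ++ t ++ t′     ∎)
      where open ≡-Reasoning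

    u-nth : ∀ {i} N → i < length (φⁿ0 a b N) → u a b i ≡ nth (φⁿ0 a b N) i
    u-nth {i} N i<len with ≤-total N (suc i)
    ... | inj₁ N≤1+i with t , eq ← φⁿ0-prefix (≤⇒≤′ N≤1+i) =
      trans (cong (λ w → nth w i) eq) (nth-++ˡ (φⁿ0 a b N) t i<len)
    ... | inj₂ 1+i≤N with t , eq ← φⁿ0-prefix (≤⇒≤′ 1+i≤N) =
      sym (trans (cong (λ w → nth w i) eq) (nth-++ˡ (φⁿ0 a b (suc i)) t (<⇒≤ (n<length-φⁿ0 (suc i)))))

    Factor⇒BlockFactor : ∀ {w} → Factor (u a b) w → BlockFactor w
    Factor⇒BlockFactor {w} (i , eq) = φⁿ0 a b N , take i W , drop (length w) (drop i W) , (begin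
        W                                                      ≡⟨ take++drop≡id i W ⟨
        take i W ++ drop i W                                   ≡⟨ cong (take i W ++_) (take++drop≡id (length w) (drop i W)) ⟨
        take i W ++ take (length w) (drop i W) ++ drop (length w) (drop i W)
                                                               ≡⟨ cong (λ v → take i W ++ v ++ drop (length w) (drop i W)) w≡slice ⟨
        take i W ++ w ++ drop (length w) (drop i W)            ∎)
      where
      open ≡-Reasoning
      N = i + length w
      W = φⁿ0 a b (suc N)
      fits : i + length w ≤ length W
      fits = ≤-trans (n≤1+n N) (<⇒≤ (n<length-φⁿ0 (suc N)))
      w≡slice : w ≡ take (length w) (drop i W)
      w≡slice = begin
        w                                                       ≡⟨ eq ⟨
        tabulate (λ j → u a b (i + toℕ j))                      ≡⟨ tabulate-cong (λ j → u-nth (suc N) (<-≤-trans (+-monoʳ-< i (toℕ<n j)) fits)) ⟩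
        tabulate (λ j → nth W (i + toℕ j))                      ≡⟨ tabulate-nth W i (length w) fits ⟩
        take (length w) (drop i W)                              ∎

  BlockFactor-short-gap : ∀ {k s} → BlockFactor (𝟙 ∷ replicate k 𝟘 ++ 𝟙 ∷ s) → k < a → k ≡ b
  BlockFactor-short-gap gap k<a with BlockFactor-gap gap
  ... | inj₁ refl = ⊥-elim (<-irrefl refl k<a)
  ... | inj₂ k≡b  = k≡b

  module _ (1≤a : 1 ≤ a) (b≤a : b ≤ a) where

    left-special-prefix : ∀ {v} → LeftSpecial (u a b) v → 𝟙 ∈ v → HasPrefix v (replicate b 𝟘 ++ 𝟙 ∷ [])
    left-special-prefix (c , d , c≢d , fc , fd) 𝟙∈v
      with k , w , refl ← first-𝟙 𝟙∈v
      with f𝟘 , f𝟙 ← both-letters (λ e → Factor (u a b) (e ∷ replicate k 𝟘 ++ 𝟙 ∷ w)) c≢d fc fd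
      with refl ← BlockFactor-short-gap (Factor⇒BlockFactor 1≤a f𝟙)
                    (BlockFactor-zero-run b≤a (Factor⇒BlockFactor 1≤a f𝟘)) =
      w , sym (++-assoc (replicate b 𝟘) (𝟙 ∷ []) w)

    right-special-suffix : ∀ {v} → RightSpecial (u a b) v → 𝟙 ∈ v → HasSuffix v (𝟙 ∷ replicate b 𝟘)
    right-special-suffix (c , d , c≢d , fc , fd) 𝟙∈v
      with w , k , refl ← last-𝟙 𝟙∈v
      with f𝟘 , f𝟙 ← both-letters (λ e → Factor (u a b) ((w ++ 𝟙 ∷ replicate k 𝟘) ++ e ∷ [])) c≢d fc fd
      = w , cong (λ n → w ++ 𝟙 ∷ replicate n 𝟘) (BlockFactor-short-gap gap (subst (_≤ a) (+-comm k 1) k+1≤a))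
      where
      gap : BlockFactor (𝟙 ∷ replicate k 𝟘 ++ 𝟙 ∷ [])
      gap = BlockFactor-suffix w (subst BlockFactor (++-assoc w _ _) (Factor⇒BlockFactor 1≤a f𝟙))
      k+1≤a : k + 1 ≤ a
      k+1≤a = BlockFactor-zero-run b≤a {s = []}
        (BlockFactor-suffix (𝟙 ∷ []) (BlockFactor-suffix w
          (subst BlockFactor (trans (++-assoc w _ _) (cong (λ z → w ++ 𝟙 ∷ z) (replicate-+-++ k 1 𝟘)))
            (Factor⇒BlockFactor 1≤a f𝟘))))

lemma4p1 : (a b : ℕ) → 1 ≤ b → b + 1 < a →
    ((r : ℕ) → Factor (u a b) (𝟙 ∷ replicate r 𝟘 ++ 𝟙 ∷ []) → (r ≡ a ⊎ r ≡ b))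
    × ((v : List Letter) → LeftSpecial (u a b) v → 𝟙 ∈ v →
         HasPrefix v (replicate b 𝟘 ++ 𝟙 ∷ []))
    × ((v : List Letter) → RightSpecial (u a b) v → 𝟙 ∈ v →
         HasSuffix v (𝟙 ∷ replicate b 𝟘))
lemma4p1 a b 1≤b b+1<a =
    (λ r f → BlockFactor-gap a b (Factor⇒BlockFactor a b 1≤a f))
  , (λ v → left-special-prefix a b 1≤a b≤a)
  , (λ v → right-special-suffix a b 1≤a b≤a)
  where
  b≤a : b ≤ a
  b≤a = m+n≤o⇒m≤o b (<⇒≤ b+1<a)
  1≤a : 1 ≤ a
  1≤a = ≤-trans 1≤b b≤a
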